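{- Let $V$ be a finite non-empty set and $T:\mathscr{P}(V)\to\mathscr{P}(V)$ a map. If $(E_1,E_2)$ is the unique pair of equivalence relations on $V$ with $T(X)=\mathbf{l}_{E_2}(\mathbf{l}_{E_1}(X))$ for all $X\subseteq V$, then $|E_1|<2^{|E_2|}$ and $|E_2|<2^{|E_1|}$, where $|E|$ denotes the number of equivalence classes of $E$.
   Context: For an equivalence relation $E$ on $V$: $\mathbf{l}_E(X)=\{x\in V:[x]_E\subseteq X\}$. -}

module Defs where

open import Data.Bool using (Bool; true; false; not; _∨_; _∧_)
import Data.Bool as Bool
open import Data.Nat using (ℕ)
open import Data.Fin using (Fin)
open import Data.Vec using (Vec; tabulate; lookup)
open import Data.Vec.Properties using (≡-dec)
open import Data.List using (List; foldr; map; length; deduplicate; allFin)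
open import Data.Fin.Subset using (Subset)
open import Relation.Binary.PropositionalEquality using (_≡_)

BRel : ℕ → Set
BRel n = Fin n → Fin n → Bool

allB : {A : Set} → (A → Bool) → List A → Bool
allB p = foldr (λ a b → p a ∧ b) true

record IsEquivRel {n : ℕ} (E : BRel n) : Set where
  field
    reflE  : ∀ x → E x x ≡ true
    symE   : ∀ x y → E x y ≡ true → E y x ≡ true
    transE : ∀ x y z → E x y ≡ true → E y z ≡ true → E x z ≡ true

eqClass : {n : ℕ} → BRel n → Fin n → Subset n
eqClass E x = tabulate (λ y → E x y)

-- l_E(X) = { x ∈ V : [x]_E ⊆ X }.
lowerE : {n : ℕ} → BRel n → Subset n → Subset n
lowerE {n} E X = tabulate (λ x → allB (λ y → not (E x y) ∨ lookup X y) (allFin n))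

numClasses : {n : ℕ} → BRel n → ℕ
numClasses {n} E = length (deduplicate (≡-dec Bool._≟_) (map (eqClass E) (allFin n)))

SameRel : {n : ℕ} → BRel n → BRel n → Set
SameRel E F = ∀ x y → E x y ≡ F x y

Represents : {n : ℕ} → (Subset n → Subset n) → BRel n → BRel n → Set
Represents T E₁ E₂ =
  IsEquivRel E₁ × IsEquivRel E₂ × (∀ X → T X ≡ lowerE E₂ (lowerE E₁ X))
  where open import Data.Product using (_×_)

-- Then x ∈ T X iff every z reachable from x by an
-- E₂-step followed by an E₁-step lies in X, so T only depends on the composite relation
-- E₂ ⨾ E₁.  Call the set of E₂-classes met by an E₁-class its trace.  If two E₁-classes
-- have the same trace, merging them leaves E₂ ⨾ E₁ unchanged, and dually for two E₂-classes
-- with the same trace on E₁-classes.  Uniqueness of the representation therefore forces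
-- distinct classes to have distinct traces, and pigeonhole on the 2^k − 1 non-empty traces
-- gives both bounds.
module Submission where

open import Defs
open import Data.Bool using (Bool; true; false; not; _∨_; _∧_)
import Data.Bool as Bool
open import Data.Fin using (Fin; zero; suc; funToFin; finToFun) renaming (_<_ to _<ᶠ_)
open import Data.Fin.Properties using (pigeonhole; any?; 2↔Bool; finToFun-funToFin; <⇒≢)
open import Data.Fin.Subset using (Subset; _∈_; _⊆_)
open import Data.Fin.Subset.Properties using (⊆-antisym)
open import Data.List using (List; []; _∷_; allFin; deduplicate; map)
import Data.List as List
open import Data.List.Membership.Propositional using () renaming (_∈_ to _∈ₗ_)
open import Data.List.Membership.Propositional.Properties
  using (∈-lookup; ∈-allFin; ∈-map⁺; ∈-map⁻; ∈-deduplicate⁺; ∈-deduplicate⁻)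
open import Data.List.Relation.Unary.All using (All; []; _∷_)
import Data.List.Relation.Unary.All as All
open import Data.List.Relation.Unary.All.Properties using (tabulate⁺; tabulate⁻)
open import Data.List.Relation.Unary.AllPairs using (_∷_)
open import Data.List.Relation.Unary.Any using (index)
open import Data.List.Relation.Unary.Any.Properties using (lookup-index)
open import Data.List.Relation.Unary.Unique.Propositional using (Unique)
open import Data.List.Relation.Unary.Unique.DecPropositional.Properties using (deduplicate-!)
open import Data.Nat using (ℕ; suc; _<_; _≤_; _^_; s≤s)
open import Data.Nat.Properties using (_≤?_; ≰⇒>)
open import Data.Product using (_×_; ∃; ∃₂; _,_; proj₁; proj₂)
open import Data.Sum using (_⊎_; inj₁; inj₂)
open import Data.Vec using (tabulate; lookup)
open import Data.Vec.Properties
  using (≡-dec; lookup∘tabulate; tabulate-cong; lookup⇒[]=; []=⇒lookup)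
open import Function using (_∘_; _⇔_; mk⇔; Equivalence; Inverse)
open import Relation.Nullary using (Dec; yes; no; does; contradiction)
open import Relation.Nullary.Decidable using (dec-true; _×-dec_)
open import Relation.Binary.Core using (_⇒_)
open import Relation.Binary.PropositionalEquality
  using (_≡_; _≢_; _≗_; refl; sym; trans; cong; module ≡-Reasoning)

∨-true⁻ : ∀ a b → a ∨ b ≡ true → a ≡ true ⊎ b ≡ true
∨-true⁻ true  _ _ = inj₁ refl
∨-true⁻ false _ p = inj₂ p

∨-true⁺ : ∀ {a b} → a ≡ true ⊎ b ≡ true → a ∨ b ≡ true
∨-true⁺ {true}  _        = refl
∨-true⁺ {false} (inj₂ p) = p

∧-true⁻ : ∀ a b → a ∧ b ≡ true → a ≡ true × b ≡ true
∧-true⁻ true true _ = refl , refl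

∧-true⁺ : ∀ {a b} → a ≡ true → b ≡ true → a ∧ b ≡ true
∧-true⁺ refl refl = refl

true-⇔⇒≡ : ∀ {a b} → (a ≡ true → b ≡ true) → (b ≡ true → a ≡ true) → a ≡ b
true-⇔⇒≡ {true}  {true}  _ _ = refl
true-⇔⇒≡ {true}  {false} f _ = sym (f refl)
true-⇔⇒≡ {false} {true}  _ g = g refl
true-⇔⇒≡ {false} {false} _ _ = refl

implication-true⁻ : ∀ a b → not a ∨ b ≡ true → a ≡ true → b ≡ true
implication-true⁻ true _ h refl = h

implication-true⁺ : ∀ a b → (a ≡ true → b ≡ true) → not a ∨ b ≡ true
implication-true⁺ true  _ h = h refl
implication-true⁺ false _ _ = refl

does-true⇒ : ∀ {A : Set} (a? : Dec A) → does a? ≡ true → A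
does-true⇒ (yes a) _ = a

allB-true⁻ : ∀ {A : Set} (p : A → Bool) xs → allB p xs ≡ true → All (λ x → p x ≡ true) xs
allB-true⁻ p []       _ = []
allB-true⁻ p (x ∷ xs) h = proj₁ (∧-true⁻ (p x) _ h) ∷ allB-true⁻ p xs (proj₂ (∧-true⁻ (p x) _ h))

allB-true⁺ : ∀ {A : Set} (p : A → Bool) {xs} → All (λ x → p x ≡ true) xs → allB p xs ≡ true
allB-true⁺ p []         = refl
allB-true⁺ p (px ∷ pxs) = ∧-true⁺ px (allB-true⁺ p pxs)

lookup-injective : ∀ {A : Set} {xs : List A} → Unique xs →
                   ∀ {i j} → List.lookup xs i ≡ List.lookup xs j → i ≡ j
lookup-injective (_  ∷ _) {zero}  {zero}  _  = refl
lookup-injective (x∉ ∷ _) {zero}  {suc j} eq = contradiction eq (All.lookup x∉ (∈-lookup j))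
lookup-injective (x∉ ∷ _) {suc i} {zero}  eq = contradiction (sym eq) (All.lookup x∉ (∈-lookup i))
lookup-injective (_  ∷ u) {suc i} {suc j} eq = cong suc (lookup-injective u eq)

encode : ∀ {k} → (Fin k → Bool) → Fin (2 ^ k)
encode t = funToFin (Inverse.from 2↔Bool ∘ t)

encode-injective : ∀ {k} (s t : Fin k → Bool) → encode s ≡ encode t → s ≗ t
encode-injective s t eq q = begin
  s q                         ≡⟨ sym (Inverse.strictlyInverseˡ 2↔Bool (s q)) ⟩
  bit (fromBool (s q))        ≡⟨ cong bit (sym (finToFun-funToFin (fromBool ∘ s) q)) ⟩
  bit (finToFun (encode s) q) ≡⟨ cong (λ c → bit (finToFun c q)) eq ⟩
  bit (finToFun (encode t) q) ≡⟨ cong bit (finToFun-funToFin (fromBool ∘ t) q) ⟩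
  bit (fromBool (t q))        ≡⟨ Inverse.strictlyInverseˡ 2↔Bool (t q) ⟩
  t q                         ∎
  where
  open ≡-Reasoning
  bit : Fin 2 → Bool
  bit = Inverse.to 2↔Bool
  fromBool : Bool → Fin 2
  fromBool = Inverse.from 2↔Bool

-- The extra pigeon is the empty trace, which no t i can collide with.
pigeonhole-nonempty : ∀ {m k} (t : Fin m → Fin k → Bool) → 2 ^ k ≤ m →
                      (∀ i → ∃ λ q → t i q ≡ true) → ∃₂ λ i j → i ≢ j × t i ≗ t j
pigeonhole-nonempty {m} {k} t 2^k≤m nonempty = collision (pigeonhole (s≤s 2^k≤m) code)
  where
  code : Fin (suc m) → Fin (2 ^ k)
  code zero    = encode {k} (λ _ → false)
  code (suc i) = encode (t i)

  collision : (∃₂ λ i j → i <ᶠ j × code i ≡ code j) → ∃₂ λ i j → i ≢ j × t i ≗ t j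
  collision (zero  , suc j , _   , eq) with nonempty j
  ... | q , tjq = contradiction (trans (encode-injective (λ _ → false) (t j) eq q) tjq) λ ()
  collision (suc i , suc j , i<j , eq) =
    i , j , <⇒≢ i<j ∘ cong suc , encode-injective (t i) (t j) eq

module _ {n : ℕ} where

  ∈-lowerE⁻ : ∀ (E : BRel n) X {x y} → x ∈ lowerE E X → E x y ≡ true → y ∈ X
  ∈-lowerE⁻ E X {x} {y} x∈ Exy = lookup⇒[]= y X (implication-true⁻ (E x y) _ holds Exy)
    where
    holds : not (E x y) ∨ lookup X y ≡ true
    holds = tabulate⁻ (allB-true⁻ _ (allFin n) (trans (sym (lookup∘tabulate _ x)) ([]=⇒lookup x∈)))
                      y

  ∈-lowerE⁺ : ∀ (E : BRel n) X {x} → (∀ {y} → E x y ≡ true → y ∈ X) → x ∈ lowerE E X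
  ∈-lowerE⁺ E X {x} h =
    lookup⇒[]= x (lowerE E X) (trans (lookup∘tabulate _ x) (allB-true⁺ _ (tabulate⁺ holds)))
    where
    holds : ∀ y → not (E x y) ∨ lookup X y ≡ true
    holds y = implication-true⁺ (E x y) _ ([]=⇒lookup ∘ h)

  _⨾_ : BRel n → BRel n → Fin n → Fin n → Set
  (E ⨾ F) x z = ∃ λ y → E x y ≡ true × F y z ≡ true

  lowerE² : BRel n → BRel n → Subset n → Subset n
  lowerE² E₂ E₁ X = lowerE E₂ (lowerE E₁ X)

  ∈-lowerE²⁻ : ∀ (E₂ E₁ : BRel n) X {x z} → x ∈ lowerE² E₂ E₁ X → (E₂ ⨾ E₁) x z → z ∈ X
  ∈-lowerE²⁻ E₂ E₁ X x∈ (_ , E₂xy , E₁yz) =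
    ∈-lowerE⁻ E₁ X (∈-lowerE⁻ E₂ (lowerE E₁ X) x∈ E₂xy) E₁yz

  lowerE²-antitone : ∀ (E₂ E₁ F₂ F₁ : BRel n) → F₂ ⨾ F₁ ⇒ E₂ ⨾ E₁ →
                     ∀ X → lowerE² E₂ E₁ X ⊆ lowerE² F₂ F₁ X
  lowerE²-antitone E₂ E₁ F₂ F₁ F⇒E X x∈ =
    ∈-lowerE⁺ F₂ (lowerE F₁ X) λ F₂xy → ∈-lowerE⁺ F₁ X λ F₁yz →
      ∈-lowerE²⁻ E₂ E₁ X x∈ (F⇒E (_ , F₂xy , F₁yz))

  lowerE²-cong : ∀ (E₂ E₁ F₂ F₁ : BRel n) → E₂ ⨾ E₁ ⇒ F₂ ⨾ F₁ → F₂ ⨾ F₁ ⇒ E₂ ⨾ E₁ →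
                 ∀ X → lowerE² E₂ E₁ X ≡ lowerE² F₂ F₁ X
  lowerE²-cong E₂ E₁ F₂ F₁ E⇒F F⇒E X =
    ⊆-antisym (lowerE²-antitone E₂ E₁ F₂ F₁ F⇒E X) (lowerE²-antitone F₂ F₁ E₂ E₁ E⇒F X)

  InUnion : BRel n → Fin n → Fin n → Fin n → Set
  InUnion E a b x = E x a ≡ true ⊎ E x b ≡ true

  merge : BRel n → Fin n → Fin n → BRel n
  merge E a b x y = E x y ∨ ((E x a ∨ E x b) ∧ (E y a ∨ E y b))

  merge⁻ : ∀ E a b {x y} → merge E a b x y ≡ true →
           E x y ≡ true ⊎ (InUnion E a b x × InUnion E a b y)
  merge⁻ E a b {x} {y} h with ∨-true⁻ (E x y) _ h
  ... | inj₁ Exy  = inj₁ Exy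
  ... | inj₂ both with ∧-true⁻ (E x a ∨ E x b) _ both
  ...   | x∈ , y∈ = inj₂ (∨-true⁻ (E x a) _ x∈ , ∨-true⁻ (E y a) _ y∈)

  merge⁺ : ∀ E a b {x y} → E x y ≡ true ⊎ (InUnion E a b x × InUnion E a b y) →
           merge E a b x y ≡ true
  merge⁺ E a b (inj₁ Exy)       = ∨-true⁺ (inj₁ Exy)
  merge⁺ E a b (inj₂ (x∈ , y∈)) = ∨-true⁺ (inj₂ (∧-true⁺ (∨-true⁺ x∈) (∨-true⁺ y∈)))

  module _ {E : BRel n} (isEquiv : IsEquivRel E) (a b : Fin n) where
    open IsEquivRel isEquiv

    InUnion-resp : ∀ {x y} → E x y ≡ true → InUnion E a b x → InUnion E a b y
    InUnion-resp {x} {y} Exy (inj₁ Exa) = inj₁ (transE y x a (symE x y Exy) Exa)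
    InUnion-resp {x} {y} Exy (inj₂ Exb) = inj₂ (transE y x b (symE x y Exy) Exb)

    merge-isEquivRel : IsEquivRel (merge E a b)
    merge-isEquivRel = record
      { reflE  = λ x → merge⁺ E a b (inj₁ (reflE x))
      ; symE   = λ x y → merge⁺ E a b ∘ sym′ ∘ merge⁻ E a b
      ; transE = λ x y z p q → merge⁺ E a b (trans′ (merge⁻ E a b p) (merge⁻ E a b q))
      }
      where
      sym′ : ∀ {x y} → E x y ≡ true ⊎ (InUnion E a b x × InUnion E a b y) →
                       E y x ≡ true ⊎ (InUnion E a b y × InUnion E a b x)
      sym′ {x} {y} (inj₁ Exy)       = inj₁ (symE x y Exy)
      sym′         (inj₂ (x∈ , y∈)) = inj₂ (y∈ , x∈)

      trans′ : ∀ {x y z} → E x y ≡ true ⊎ (InUnion E a b x × InUnion E a b y) →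
                           E y z ≡ true ⊎ (InUnion E a b y × InUnion E a b z) →
                           E x z ≡ true ⊎ (InUnion E a b x × InUnion E a b z)
      trans′ {x} {y} {z} (inj₁ Exy)     (inj₁ Eyz)       = inj₁ (transE x y z Exy Eyz)
      trans′ {x} {y}     (inj₁ Exy)     (inj₂ (y∈ , z∈)) = inj₂ (InUnion-resp (symE x y Exy) y∈ , z∈)
      trans′             (inj₂ (x∈ , y∈)) (inj₁ Eyz)     = inj₂ (x∈ , InUnion-resp Eyz y∈)
      trans′             (inj₂ (x∈ , _))  (inj₂ (_ , z∈)) = inj₂ (x∈ , z∈)

    merge-merges : merge E a b a b ≡ true
    merge-merges = merge⁺ E a b (inj₂ (inj₁ (reflE a) , inj₂ (reflE b)))

  Meets : BRel n → BRel n → Fin n → Fin n → Set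
  Meets E G a y = ∃ λ w → E a w ≡ true × G y w ≡ true

  SameTrace : BRel n → BRel n → Fin n → Fin n → Set
  SameTrace E G a b = ∀ y → Meets E G a y ⇔ Meets E G b y

  -- A G-class touching [a]_E ∪ [b]_E meets one of them, hence (same trace) both, hence it
  -- contains an element E-related to any z of the union.
  meets-union : ∀ {E G : BRel n} {a b} → IsEquivRel E → SameTrace E G a b →
                ∀ {y u z} → G y u ≡ true → InUnion E a b u → InUnion E a b z →
                ∃ λ w → G y w ≡ true × E w z ≡ true
  meets-union {E} {G} {a} {b} isEquiv same {y} {u} {z} Gyu u∈ z∈ = reach z∈
    where
    open IsEquivRel isEquiv

    meets-a-via : InUnion E a b u → Meets E G a y
    meets-a-via (inj₁ Eua) = u , symE u a Eua , Gyu
    meets-a-via (inj₂ Eub) = Equivalence.from (same y) (u , symE u b Eub , Gyu)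

    meets-a : Meets E G a y
    meets-a = meets-a-via u∈

    meets-b : Meets E G b y
    meets-b = Equivalence.to (same y) meets-a

    reach : InUnion E a b z → ∃ λ w → G y w ≡ true × E w z ≡ true
    reach (inj₁ Eza) with meets-a
    ... | w , Eaw , Gyw = w , Gyw , transE w a z (symE a w Eaw) (symE z a Eza)
    reach (inj₂ Ezb) with meets-b
    ... | w , Ebw , Gyw = w , Gyw , transE w b z (symE b w Ebw) (symE z b Ezb)

  ⨾-mergeʳ : ∀ {E₂ E₁ : BRel n} {a b} → IsEquivRel E₁ → SameTrace E₁ E₂ a b →
             E₂ ⨾ merge E₁ a b ⇒ E₂ ⨾ E₁
  ⨾-mergeʳ {E₁ = E₁} {a} {b} isEquiv₁ same (y , E₂xy , Myz) with merge⁻ E₁ a b Myz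
  ... | inj₁ E₁yz      = y , E₂xy , E₁yz
  ... | inj₂ (y∈ , z∈) = meets-union isEquiv₁ same E₂xy y∈ z∈

  ⨾-mergeˡ : ∀ {E₂ E₁ : BRel n} {c d} → IsEquivRel E₂ → IsEquivRel E₁ → SameTrace E₂ E₁ c d →
             merge E₂ c d ⨾ E₁ ⇒ E₂ ⨾ E₁
  ⨾-mergeˡ {E₂} {E₁} {c} {d} isEquiv₂ isEquiv₁ same {x} {z} (y , Mxy , E₁yz) =
    compose (merge⁻ E₂ c d Mxy)
    where
    open IsEquivRel isEquiv₁ using () renaming (symE to sym₁)
    open IsEquivRel isEquiv₂ using () renaming (symE to sym₂)

    compose : E₂ x y ≡ true ⊎ (InUnion E₂ c d x × InUnion E₂ c d y) → (E₂ ⨾ E₁) x z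
    compose (inj₁ E₂xy)      = y , E₂xy , E₁yz
    compose (inj₂ (x∈ , y∈)) with meets-union isEquiv₂ same (sym₁ y z E₁yz) y∈ x∈
    ... | w , E₁zw , E₂wx = w , sym₂ w x E₂wx , sym₁ z w E₁zw

  lowerE²-mergeʳ : ∀ {E₂ E₁ : BRel n} {a b} → IsEquivRel E₁ → SameTrace E₁ E₂ a b →
                   ∀ X → lowerE² E₂ E₁ X ≡ lowerE² E₂ (merge E₁ a b) X
  lowerE²-mergeʳ {E₂} {E₁} {a} {b} isEquiv₁ same =
    lowerE²-cong E₂ E₁ E₂ (merge E₁ a b)
      (λ (y , E₂xy , E₁yz) → y , E₂xy , merge⁺ E₁ a b (inj₁ E₁yz))
      (⨾-mergeʳ isEquiv₁ same)

  lowerE²-mergeˡ : ∀ {E₂ E₁ : BRel n} {c d} → IsEquivRel E₂ → IsEquivRel E₁ → SameTrace E₂ E₁ c d →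
                   ∀ X → lowerE² E₂ E₁ X ≡ lowerE² (merge E₂ c d) E₁ X
  lowerE²-mergeˡ {E₂} {E₁} {c} {d} isEquiv₂ isEquiv₁ same =
    lowerE²-cong E₂ E₁ (merge E₂ c d) E₁
      (λ (y , E₂xy , E₁yz) → y , merge⁺ E₂ c d (inj₁ E₂xy) , E₁yz)
      (⨾-mergeˡ isEquiv₂ isEquiv₁ same)

  classes : BRel n → List (Subset n)
  classes E = deduplicate (≡-dec Bool._≟_) (map (eqClass E) (allFin n))

  classes-unique : ∀ (E : BRel n) → Unique (classes E)
  classes-unique E = deduplicate-! (≡-dec Bool._≟_) (map (eqClass E) (allFin n))

  classes-eqClass : ∀ (E : BRel n) i →
                    ∃ λ x → x ∈ₗ allFin n × List.lookup (classes E) i ≡ eqClass E x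
  classes-eqClass E i =
    ∈-map⁻ (eqClass E) (∈-deduplicate⁻ _ (map (eqClass E) (allFin n)) (∈-lookup i))

  representative : ∀ (E : BRel n) → Fin (numClasses E) → Fin n
  representative E i = proj₁ (classes-eqClass E i)

  eqClass-representative : ∀ (E : BRel n) i →
                           eqClass E (representative E i) ≡ List.lookup (classes E) i
  eqClass-representative E i = sym (proj₂ (proj₂ (classes-eqClass E i)))

  eqClass∈classes : ∀ (E : BRel n) x → eqClass E x ∈ₗ classes E
  eqClass∈classes E x = ∈-deduplicate⁺ (≡-dec Bool._≟_) (∈-map⁺ (eqClass E) (∈-allFin x))

  classIndex : ∀ (E : BRel n) → Fin n → Fin (numClasses E)
  classIndex E x = index (eqClass∈classes E x)

  lookup-classIndex : ∀ (E : BRel n) x → List.lookup (classes E) (classIndex E x) ≡ eqClass E x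
  lookup-classIndex E x = sym (lookup-index (eqClass∈classes E x))

  module _ {E : BRel n} (isEquiv : IsEquivRel E) where
    open IsEquivRel isEquiv

    eqClass-≡⇒related : ∀ {a b} → eqClass E a ≡ eqClass E b → E a b ≡ true
    eqClass-≡⇒related {a} {b} eq = begin
      E a b                  ≡⟨ sym (lookup∘tabulate (E a) b) ⟩
      lookup (eqClass E a) b ≡⟨ cong (λ C → lookup C b) eq ⟩
      lookup (eqClass E b) b ≡⟨ lookup∘tabulate (E b) b ⟩
      E b b                  ≡⟨ reflE b ⟩
      true                   ∎
      where open ≡-Reasoning

    related⇒eqClass-≡ : ∀ {a b} → E a b ≡ true → eqClass E a ≡ eqClass E b
    related⇒eqClass-≡ {a} {b} Eab =
      tabulate-cong λ y → true-⇔⇒≡ (transE b a y (symE a b Eab)) (transE a b y Eab)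

    representative-classIndex : ∀ x → E (representative E (classIndex E x)) x ≡ true
    representative-classIndex x =
      eqClass-≡⇒related (trans (eqClass-representative E (classIndex E x)) (lookup-classIndex E x))

    representatives-unrelated : ∀ {i j} → i ≢ j →
                                E (representative E i) (representative E j) ≢ true
    representatives-unrelated {i} {j} i≢j Eab = i≢j (lookup-injective (classes-unique E) (begin
      List.lookup (classes E) i      ≡⟨ sym (eqClass-representative E i) ⟩
      eqClass E (representative E i) ≡⟨ related⇒eqClass-≡ Eab ⟩
      eqClass E (representative E j) ≡⟨ eqClass-representative E j ⟩
      List.lookup (classes E) j      ∎))
      where open ≡-Reasoning

  meets? : ∀ (E G : BRel n) a y → Dec (Meets E G a y)
  meets? E G a y = any? λ w → (E a w Bool.≟ true) ×-dec (G y w Bool.≟ true)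

  trace : ∀ (E G : BRel n) → Fin (numClasses E) → Fin (numClasses G) → Bool
  trace E G i q = does (meets? E G (representative E i) (representative G q))

  module _ {E G : BRel n} (isEquivE : IsEquivRel E) (isEquivG : IsEquivRel G) where
    open IsEquivRel isEquivG using (symE; transE)

    meets-resp : ∀ {a y y′} → G y y′ ≡ true → Meets E G a y → Meets E G a y′
    meets-resp {y = y} {y′} Gyy′ (w , Eaw , Gyw) = w , Eaw , transE y′ y w (symE y y′ Gyy′) Gyw

    trace-nonempty : ∀ i → ∃ λ q → trace E G i q ≡ true
    trace-nonempty i = classIndex G a , dec-true (meets? E G a _) meets-own-class
      where
      a : Fin n
      a = representative E i
      meets-own-class : Meets E G a (representative G (classIndex G a))
      meets-own-class = a , IsEquivRel.reflE isEquivE a , representative-classIndex isEquivG a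

    trace-transfer : ∀ {i j} → trace E G i ≗ trace E G j →
                     ∀ y → Meets E G (representative E i) y → Meets E G (representative E j) y
    trace-transfer {i} {j} same y meets-i = meets-resp Gry (does-true⇒ (meets? E G _ r) bit-j)
      where
      q : Fin (numClasses G)
      q = classIndex G y
      r : Fin n
      r = representative G q
      Gry : G r y ≡ true
      Gry = representative-classIndex isEquivG y
      bit-j : trace E G j q ≡ true
      bit-j = trans (sym (same q)) (dec-true (meets? E G _ r) (meets-resp (symE r y Gry) meets-i))

    trace-≗⇒SameTrace : ∀ {i j} → trace E G i ≗ trace E G j →
                        SameTrace E G (representative E i) (representative E j)
    trace-≗⇒SameTrace same y = mk⇔ (trace-transfer same y) (trace-transfer (sym ∘ same) y)

    numClasses-bound : (∀ {a b} → SameTrace E G a b → E a b ≡ true) →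
                       numClasses E < 2 ^ numClasses G
    numClasses-bound sameTrace⇒related with 2 ^ numClasses G ≤? numClasses E
    ... | no  2^k≰m = ≰⇒> 2^k≰m
    ... | yes 2^k≤m with pigeonhole-nonempty (trace E G) 2^k≤m trace-nonempty
    ...   | i , j , i≢j , same =
      contradiction (sameTrace⇒related (trace-≗⇒SameTrace same))
                    (representatives-unrelated isEquivE i≢j)

module _ {n : ℕ} {T : Subset n → Subset n} {E₁ E₂ : BRel n} (represents : Represents T E₁ E₂)
         (unique : ∀ F₁ F₂ → Represents T F₁ F₂ → SameRel F₁ E₁ × SameRel F₂ E₂) where
  open ≡-Reasoning

  private
    isEquiv₁ : IsEquivRel E₁
    isEquiv₁ = proj₁ represents

    isEquiv₂ : IsEquivRel E₂
    isEquiv₂ = proj₁ (proj₂ represents)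

    T≡lowerE² : ∀ X → T X ≡ lowerE² E₂ E₁ X
    T≡lowerE² = proj₂ (proj₂ represents)

  sameTrace⇒related₁ : ∀ {a b} → SameTrace E₁ E₂ a b → E₁ a b ≡ true
  sameTrace⇒related₁ {a} {b} same = begin
    E₁ a b           ≡⟨ sym (proj₁ (unique (merge E₁ a b) E₂ merged-represents) a b) ⟩
    merge E₁ a b a b ≡⟨ merge-merges isEquiv₁ a b ⟩
    true             ∎
    where
    merged-represents : Represents T (merge E₁ a b) E₂
    merged-represents = merge-isEquivRel isEquiv₁ a b , isEquiv₂ ,
                        λ X → trans (T≡lowerE² X) (lowerE²-mergeʳ isEquiv₁ same X)

  sameTrace⇒related₂ : ∀ {c d} → SameTrace E₂ E₁ c d → E₂ c d ≡ true
  sameTrace⇒related₂ {c} {d} same = begin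
    E₂ c d           ≡⟨ sym (proj₂ (unique E₁ (merge E₂ c d) merged-represents) c d) ⟩
    merge E₂ c d c d ≡⟨ merge-merges isEquiv₂ c d ⟩
    true             ∎
    where
    merged-represents : Represents T E₁ (merge E₂ c d)
    merged-represents = isEquiv₁ , merge-isEquivRel isEquiv₂ c d ,
                        λ X → trans (T≡lowerE² X) (lowerE²-mergeˡ isEquiv₂ isEquiv₁ same X)

mainTheorem6 : (m : ℕ) → (T : Subset (suc m) → Subset (suc m))
    → (E₁ E₂ : BRel (suc m))
    → Represents T E₁ E₂
    → (∀ F₁ F₂ → Represents T F₁ F₂ → SameRel F₁ E₁ × SameRel F₂ E₂)
    → (numClasses E₁ < 2 ^ numClasses E₂) × (numClasses E₂ < 2 ^ numClasses E₁)
mainTheorem6 m T E₁ E₂ represents@(isEquiv₁ , isEquiv₂ , _) unique =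
  numClasses-bound isEquiv₁ isEquiv₂ (sameTrace⇒related₁ represents unique) ,
  numClasses-bound isEquiv₂ isEquiv₁ (sameTrace⇒related₂ represents unique)
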